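{- Let $\mathcal G=(V,E)$ be a graph in which loops are allowed, with $E\neq\emptyset$, and suppose $\mathcal G$ is quasi-projective (within the class of graphs with loops allowed). Then every vertex of $\mathcal G$ has a loop.
   Context: Graphs are undirected: $E$ is a set of unordered pairs of (not necessarily distinct) vertices; a loop is an edge joining a vertex to itself, and loops are allowed in all graphs considered (including the targets $\mathcal T$ below). A homomorphism is a map of vertices sending edges to edges; an epimorphism is a surjective homomorphism. A graph $\mathcal S$ is quasi-projective if for every such graph $\mathcal T$, every homomorphism $f:\mathcal S\to\mathcal T$ and every epimorphism $j:\mathcal S\to\mathcal T$, there is an endomorphism $\phi$ of $\mathcal S$ with $j\circ\phi=f$. -}

module Defs where

open import Data.Product using (Σ; ∃; _×_; _,_)
open import Relation.Binary.PropositionalEquality using (_≡_)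
open import Function using (_∘_)

-- An undirected graph with loops allowed: a vertex type and an edge relation
-- that is symmetric (edges are unordered pairs {u,v}, possibly u = v).
record Graph : Set₁ where
  field
    V    : Set
    E    : V → V → Set
    symE : ∀ {u v} → E u v → E v u
open Graph public

IsHom : (S T : Graph) → (V S → V T) → Set
IsHom S T f = ∀ {u v} → E S u v → E T (f u) (f v)

IsSurj : {A B : Set} → (A → B) → Set
IsSurj {A} {B} f = ∀ (b : B) → Σ A (λ a → f a ≡ b)

IsEpi : (S T : Graph) → (V S → V T) → Set
IsEpi S T j = IsHom S T j × IsSurj j

QuasiProjective : Graph → Set₁
QuasiProjective S =
  ∀ (T : Graph) (f j : V S → V T) → IsHom S T f → IsEpi S T j →
  Σ (V S → V S) (λ φ → IsHom S S φ × (∀ x → j (φ x) ≡ f x))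

HasEdge : Graph → Set
HasEdge G = Σ (V G) (λ u → Σ (V G) (λ v → E G u v))

{-# OPTIONS --safe #-}
module Submission where

open import Defs
open import Data.Product using (Σ; _×_; _,_)
open import Data.Sum using (_⊎_; inj₁; inj₂)
open import Relation.Binary.PropositionalEquality using (_≡_; refl; subst₂)

-- Adjoin a loop at x: the identity G → G with a loop at x is onto, while the
-- constant map at x is a homomorphism into it. A lift of the constant map
-- along the identity is an endomorphism of G that is itself constant at x,
-- so it sends any edge of G to a loop at x.

withLoopAt : (G : Graph) → V G → Graph
withLoopAt G x = record
  { V    = V G
  ; E    = λ a b → E G a b ⊎ (a ≡ x × b ≡ x)
  ; symE = λ { (inj₁ e) → inj₁ (symE G e) ; (inj₂ (a≡x , b≡x)) → inj₂ (b≡x , a≡x) }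
  }

id-isEpi-withLoopAt : (G : Graph) (x : V G) → IsEpi G (withLoopAt G x) (λ y → y)
id-isEpi-withLoopAt G x = inj₁ , λ b → b , refl

const-isHom-withLoopAt : (G : Graph) (x : V G) → IsHom G (withLoopAt G x) (λ _ → x)
const-isHom-withLoopAt G x _ = inj₂ (refl , refl)

constEndo⇒loop : (G : Graph) (x : V G) (φ : V G → V G) →
                 IsHom G G φ → (∀ y → φ y ≡ x) → HasEdge G → E G x x
constEndo⇒loop G x φ φ-hom φ≡x (u , v , e) = subst₂ (E G) (φ≡x u) (φ≡x v) (φ-hom e)

lemma4p4 : (G : Graph) → HasEdge G → QuasiProjective G → ∀ (x : V G) → E G x x
lemma4p4 G edge qp x
  with qp (withLoopAt G x) (λ _ → x) (λ y → y)
          (const-isHom-withLoopAt G x) (id-isEpi-withLoopAt G x)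
... | φ , φ-hom , φ≡x = constEndo⇒loop G x φ φ-hom φ≡x edge
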